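{- Let $k$ be a positive integer, let $\sigma_1,\dots,\sigma_n$ be disjoint paths of length one, and $P=\{\sigma_1,\dots,\sigma_n\}$. Then there exists a $k$-interlacing of these paths if and only if $n\leq k$. Also, if $n\leq k$, then $\phi_k(P)=n!$.
   Context: For distinct $a_1,\dots,a_\ell$, the path $[a_1a_2\cdots a_\ell]$ is the partial one-to-one map sending $a_i\mapsto a_{i+1}$ for $i<\ell$ and undefined at $a_\ell$ (so a path of length one $[a]$ is the nowhere-defined map on $\{a\}$); the cycle $(a_1\cdots a_\ell)$ sends $a_i\mapsto a_{i+1}$ for $i<\ell$ and $a_\ell\mapsto a_1$. Its length is $\ell$ and $a_1,\dots,a_\ell$ are its digits. Paths/cycles are disjoint if their digit sets are disjoint, and a product of disjoint paths/cycles is the partial map on the union $D$ of their digits agreeing with each one on its digits; these are elements of the symmetric inverse monoid $\mathrm{SIM}(D)$ of partial one-to-one maps $D\to D$ under composition. Given disjoint paths and/or cycles $\tau_1,\dots,\tau_r$ with union of digit sets $D$, a $k$-interlacing of them is a single path or single cycle $\beta\in\mathrm{SIM}(D)$ whose set of digits is exactly $D$ and such that $\beta^k=\tau_1\cdots\tau_r$. For a nonempty set $Q$ of disjoint paths/cycles, $\phi_k(Q)$ is the number of $k$-interlacings of the members of $Q$ (zero if there are none). -}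

module Defs where

open import Data.Nat using (ℕ; zero; suc)
open import Data.Bool using (Bool; true; false; if_then_else_)
open import Data.Maybe using (Maybe; just; nothing; _>>=_)
open import Data.List using (List; []; _∷_; _∷ʳ_; length; concatMap)
open import Data.List.Relation.Unary.All using (All)
open import Data.List.Relation.Unary.Any using (Any)
open import Data.List.Relation.Unary.AllPairs using (AllPairs)
open import Data.List.Relation.Unary.Unique.Propositional using (Unique)
open import Data.Product using (Σ; _×_; _,_; proj₁)
open import Data.Sum using (_⊎_)
open import Relation.Binary.PropositionalEquality using (_≡_; _≢_)
open import Relation.Binary.Definitions using (DecidableEquality)
open import Relation.Nullary using (¬_; does)
open import Function.Bundles using (_⇔_)
import Data.List.Membership.DecPropositional as DecMem
open import Data.List.Membership.Propositional using (_∈_)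

-- Partial maps on a type of digits A, represented as A → Maybe A
-- (nothing = undefined).  An element of SIM(D) is such a map looked at on D.
PMap : Set → Set
PMap A = A → Maybe A

_∘ₚ_ : {A : Set} → PMap A → PMap A → PMap A
(f ∘ₚ g) x = g x >>= f

_^ₚ_ : {A : Set} → PMap A → ℕ → PMap A
(β ^ₚ zero) x = just x
(β ^ₚ suc k) = β ∘ₚ (β ^ₚ k)

module _ {A : Set} (_≟_ : DecidableEquality A) where
  open DecMem _≟_ using (_∈?_)

  -- the path [a1 a2 ... al] : ai ↦ a(i+1), undefined at al (and off its digits)
  pathMap : List A → PMap A
  pathMap [] x = nothing
  pathMap (y ∷ []) x = nothing
  pathMap (y ∷ z ∷ zs) x = if does (x ≟ y) then just z else pathMap (z ∷ zs) x

  -- the cycle (a1 ... al) : ai ↦ a(i+1), al ↦ a1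
  cycleMap : List A → PMap A
  cycleMap [] x = nothing
  cycleMap (y ∷ ys) = pathMap ((y ∷ ys) ∷ʳ y)

  -- a path (false) or cycle (true), given by its digit sequence
  PathOrCycle : Set
  PathOrCycle = List A × Bool

  pcMap : PathOrCycle → PMap A
  pcMap (xs , false) = pathMap xs
  pcMap (xs , true) = cycleMap xs

  prodMap : List PathOrCycle → PMap A
  prodMap [] x = nothing
  prodMap (t ∷ ts) x = if does (x ∈? proj₁ t) then pcMap t x else prodMap ts x

  digitsOf : List PathOrCycle → List A
  digitsOf = concatMap proj₁

  -- equality of partial maps on D (equality in SIM(D))
  EqOn : List A → PMap A → PMap A → Set
  EqOn D f g = ∀ x → x ∈ D → f x ≡ g x

  IsPathOrCycleOn : List A → PMap A → Set
  IsPathOrCycleOn D β =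
    Σ (List A) λ xs → Unique xs × xs ≢ [] × (∀ x → (x ∈ xs) ⇔ (x ∈ D)) ×
      (EqOn D β (pathMap xs) ⊎ EqOn D β (cycleMap xs))

  Interlacing : ℕ → List PathOrCycle → PMap A → Set
  Interlacing k ts β =
    IsPathOrCycleOn (digitsOf ts) β × EqOn (digitsOf ts) (β ^ₚ k) (prodMap ts)

  -- φ_k(Q) = m : there are exactly m k-interlacings, counted as elements
  -- of SIM(D) (i.e. up to equality on D)
  PhiEq : ℕ → List PathOrCycle → ℕ → Set
  PhiEq k ts m =
    Σ (List (PMap A)) λ βs →
      length βs ≡ m ×
      All (Interlacing k ts) βs ×
      AllPairs (λ β γ → ¬ EqOn (digitsOf ts) β γ) βs ×
      (∀ β → Interlacing k ts β → Any (EqOn (digitsOf ts) β) βs)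

module Submission where

-- The product of the length-one paths [a₁], …, [aₙ] is the nowhere-defined
-- map on D = {a₁, …, aₙ}, so a k-interlacing is a single path or cycle β
-- on D with β^k nowhere defined on D.  Every power of a cycle is defined on
-- all of its digits, so β must be a path [x₁ … xₙ] through an arrangement
-- x₁ … xₙ of D.  Such a path is defined at x₁ after j < n steps but
-- nowhere after n steps, hence it is a k-interlacing exactly when n ≤ k.
-- Finally a path determines its digit sequence (its first digit is the one
-- digit without a preimage), so the k-interlacings are in bijection with
-- the n! arrangements of D.

open import Defs
open import Data.Nat using (ℕ; zero; suc; _+_; _*_; _≤_; _<_; _!; s≤s)
open import Data.Nat.Properties using (suc-injective; ≮⇒≥)
open import Data.Fin using (Fin)
open import Data.List using (List; []; _∷_; _∷ʳ_; map; concat; concatMap; length; allFin)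
open import Data.List.Properties using (length-map; length-++; length-tabulate; map-∘; ∷-injectiveˡ; ∷-injectiveʳ)
open import Data.Bool using (true; false; if_then_else_)
open import Data.Maybe using (Maybe; just; nothing; _>>=_)
open import Data.Maybe.Properties using (just-injective)
open import Data.Product using (Σ; ∃; _×_; _,_; proj₁)
open import Data.Sum using (inj₁; inj₂)
open import Data.Empty using (⊥-elim)
open import Function using (_on_)
open import Function.Definitions using (Injective)
open import Function.Bundles using (_⇔_; mk⇔; Equivalence)
import Function.Properties.Equivalence as ⇔
open import Relation.Binary.PropositionalEquality using (_≡_; _≢_; refl; sym; trans; cong; cong₂; subst; module ≡-Reasoning)
open import Relation.Binary.Definitions using (DecidableEquality)
open import Relation.Nullary using (¬_; yes; no)
open import Relation.Nullary.Decidable using (dec-true; dec-false)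
open import Data.List.Relation.Unary.All using (All; []; _∷_)
import Data.List.Relation.Unary.All as All
import Data.List.Relation.Unary.All.Properties as AllP
open import Data.List.Relation.Unary.Any using (Any; here; there)
import Data.List.Relation.Unary.Any.Properties as AnyP
open import Data.List.Relation.Unary.AllPairs using (AllPairs; []; _∷_)
import Data.List.Relation.Unary.AllPairs as AP
import Data.List.Relation.Unary.AllPairs.Properties as APP
open import Data.List.Relation.Unary.Unique.Propositional using (Unique)
import Data.List.Relation.Unary.Unique.Propositional.Properties as UP
open import Data.List.Relation.Binary.Disjoint.Propositional using (Disjoint)
open import Data.List.Membership.Propositional using (_∈_; _∉_; find; lose)
open import Data.List.Membership.Propositional.Properties
  using (∈-map⁺; ∈-map⁻; ∈-++⁻; ∈-concat⁺′; ∈-concatMap⁻; map∷⁻)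

open Equivalence using (to; from)

module _ {A : Set} where

  infix 4 _≐_
  _≐_ : List A → List A → Set
  xs ≐ ys = ∀ x → x ∈ xs ⇔ x ∈ ys

  ≐-trans : ∀ {xs ys zs} → xs ≐ ys → ys ≐ zs → xs ≐ zs
  ≐-trans e f x = ⇔.trans (e x) (f x)

  ≐-sym : ∀ {xs ys} → xs ≐ ys → ys ≐ xs
  ≐-sym e x = ⇔.sym (e x)

  ≐-cons : ∀ {z xs ys} → xs ≐ ys → z ∷ xs ≐ z ∷ ys
  ≐-cons e x = mk⇔ (λ { (here p) → here p ; (there m) → there (to (e x) m) })
                   (λ { (here p) → here p ; (there m) → there (from (e x) m) })

  ≐-insert : ∀ {x y r xs} → y ∷ r ≐ xs → y ∷ x ∷ r ≐ x ∷ xs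
  ≐-insert e z = mk⇔
    (λ { (here p) → there (to (e z) (here p))
       ; (there (here p)) → here p
       ; (there (there m)) → there (to (e z) (there m)) })
    (λ { (here p) → there (here p)
       ; (there m) → put-back (from (e z) m) })
    where
    put-back : ∀ {y r x} → z ∈ y ∷ r → z ∈ y ∷ x ∷ r
    put-back (here p) = here p
    put-back (there m) = there (there m)

  ≢-head : ∀ {x y : A} {xs} → Unique (y ∷ xs) → x ∈ xs → x ≢ y
  ≢-head u m refl = UP.Unique[x∷xs]⇒x∉xs u m

  unique-∷ : ∀ {x : A} {xs} → x ∉ xs → Unique xs → Unique (x ∷ xs)
  unique-∷ {xs = xs} x∉xs u = AllP.¬Any⇒All¬ xs x∉xs ∷ u

  ≐-tail : ∀ {y xs ys} → Unique (y ∷ xs) → Unique (y ∷ ys) → y ∷ xs ≐ y ∷ ys → xs ≐ ys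
  ≐-tail {y} ux uy e x = mk⇔ (drop-head ux (to (e x))) (drop-head uy (from (e x)))
    where
    drop-head : ∀ {zs ws} → Unique (y ∷ zs) → (x ∈ y ∷ zs → x ∈ y ∷ ws) → x ∈ zs → x ∈ ws
    drop-head u f m with f (there m)
    ... | here x≡y = ⊥-elim (≢-head u m x≡y)
    ... | there m′ = m′

  AllPairs-from-members : ∀ {R : A → A → Set} {xs} →
    (∀ {x y} → x ∈ xs → y ∈ xs → x ≢ y → R x y) → Unique xs → AllPairs R xs
  AllPairs-from-members f [] = []
  AllPairs-from-members f (x≢xs ∷ u) =
    All.tabulate (λ m → f (here refl) (there m) (All.lookup x≢xs m))
    ∷ AllPairs-from-members (λ m m′ → f (there m) (there m′)) u

length-concat-const : ∀ {B : Set} {c} (xss : List (List B)) →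
  All (λ xs → length xs ≡ c) xss → length (concat xss) ≡ length xss * c
length-concat-const [] [] = refl
length-concat-const (xs ∷ xss) (e ∷ es) =
  trans (length-++ xs) (cong₂ _+_ e (length-concat-const xss es))

module _ {A : Set} where

  ^ₚ-suc : ∀ (β : PMap A) k x → (β ^ₚ suc k) x ≡ (β x >>= (β ^ₚ k))
  ^ₚ-suc β zero x with β x
  ... | nothing = refl
  ... | just y = refl
  ^ₚ-suc β (suc k) x rewrite ^ₚ-suc β k x with β x
  ... | nothing = refl
  ... | just y = refl

  Closed : List A → PMap A → Set
  Closed S f = ∀ {x z} → x ∈ S → f x ≡ just z → z ∈ S

  ^ₚ-closed : ∀ {S f} → Closed S f → ∀ j → Closed S (f ^ₚ j)
  ^ₚ-closed cl zero m refl = m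
  ^ₚ-closed {f = f} cl (suc j) {x} m eq with (f ^ₚ j) x in e
  ^ₚ-closed cl (suc j) m () | nothing
  ... | just v = cl (^ₚ-closed cl j m e) eq

  ^ₚ-agree : ∀ {S f g} → (∀ x → x ∈ S → f x ≡ g x) → Closed S g →
             ∀ j x → x ∈ S → (f ^ₚ j) x ≡ (g ^ₚ j) x
  ^ₚ-agree agree cl zero x m = refl
  ^ₚ-agree {g = g} agree cl (suc j) x m rewrite ^ₚ-agree agree cl j x m with (g ^ₚ j) x in e
  ... | nothing = refl
  ... | just v = agree v (^ₚ-closed cl j m e)

  ^ₚ-total : ∀ {S f} → (∀ x → x ∈ S → f x ≢ nothing) → Closed S f →
             ∀ j x → x ∈ S → (f ^ₚ j) x ≢ nothing
  ^ₚ-total tot cl zero x m ()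
  ^ₚ-total {f = f} tot cl (suc j) x m with (f ^ₚ j) x in e
  ... | nothing = ⊥-elim (^ₚ-total tot cl j x m e)
  ... | just v = tot v (^ₚ-closed cl j m e)

module Arrangements {A : Set} where

  Arrangement : List A → List A → Set
  Arrangement D p = Unique p × p ≐ D

  putBack : A → A × List A → A × List A
  putBack x (y , r) = y , x ∷ r

  select : List A → List (A × List A)
  select [] = []
  select (x ∷ xs) = (x , xs) ∷ map (putBack x) (select xs)

  mutual
    arrangements : ℕ → List A → List (List A)
    arrangements zero _ = [] ∷ []
    arrangements (suc n) D = concatMap (headedBy n) (select D)

    headedBy : ℕ → A × List A → List (List A)
    headedBy n (y , r) = map (y ∷_) (arrangements n r)

  select-heads : ∀ D → map proj₁ (select D) ≡ D
  select-heads [] = refl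
  select-heads (x ∷ xs) = cong (x ∷_) (trans (sym (map-∘ (select xs))) (select-heads xs))

  select-length : ∀ D {y r} → (y , r) ∈ select D → length D ≡ suc (length r)
  select-length (x ∷ xs) (here refl) = refl
  select-length (x ∷ xs) (there m) with ∈-map⁻ (putBack x) m
  ... | _ , m′ , refl = cong suc (select-length xs m′)

  select-rest-length : ∀ {D n y r} → length D ≡ suc n → (y , r) ∈ select D → length r ≡ n
  select-rest-length {D} len sel = suc-injective (trans (sym (select-length D sel)) len)

  select-sound : ∀ {D y r} → Unique D → (y , r) ∈ select D → Arrangement D (y ∷ r)
  select-sound {x ∷ xs} u (here refl) = u , λ _ → ⇔.refl
  select-sound {x ∷ xs} u (there m) with ∈-map⁻ (putBack x) m
  ... | (y , r) , m′ , refl with select-sound (AP.tail u) m′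
  ... | uyr , same = unique-∷ y∉xr (unique-∷ x∉r (AP.tail uyr)) , ≐-insert same
    where
    x∉r : x ∉ r
    x∉r m″ = UP.Unique[x∷xs]⇒x∉xs u (to (same x) (there m″))
    y∉xr : y ∉ x ∷ r
    y∉xr (here y≡x) = UP.Unique[x∷xs]⇒x∉xs u (subst (_∈ xs) y≡x (to (same y) (here refl)))
    y∉xr (there m″) = UP.Unique[x∷xs]⇒x∉xs uyr m″

  select-complete : ∀ {D y} → y ∈ D → ∃ λ r → (y , r) ∈ select D
  select-complete {x ∷ xs} (here refl) = xs , here refl
  select-complete {x ∷ xs} (there m) with select-complete m
  ... | r , m′ = x ∷ r , there (∈-map⁺ (putBack x) m′)

  ∈-headedBy : ∀ n y r {p} → p ∈ headedBy n (y , r) → ∃ λ q → q ∈ arrangements n r × p ≡ y ∷ q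
  ∈-headedBy n y r = map∷⁻

  ∈-arrangements-suc : ∀ n D {p} → p ∈ arrangements (suc n) D →
    ∃ λ s → s ∈ select D × p ∈ headedBy n s
  ∈-arrangements-suc n D m = find (∈-concatMap⁻ (headedBy n) m)

  arrangements-length : ∀ n D {p} → p ∈ arrangements n D → length p ≡ n
  arrangements-length zero D (here refl) = refl
  arrangements-length (suc n) D m with ∈-arrangements-suc n D m
  ... | (y , r) , _ , m′ with ∈-headedBy n y r m′
  ... | q , q∈ , refl = cong suc (arrangements-length n r q∈)

  arrangements-sound : ∀ n {D p} → Unique D → length D ≡ n → p ∈ arrangements n D → Arrangement D p
  arrangements-sound zero {[]} u _ (here refl) = [] , λ _ → ⇔.refl
  arrangements-sound (suc n) {D} u len m with ∈-arrangements-suc n D m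
  ... | (y , r) , sel , m′ with ∈-headedBy n y r m′
  ... | q , q∈ , refl =
    let uyr , yr≐D = select-sound u sel
        uq , q≐r = arrangements-sound n (AP.tail uyr) (select-rest-length len sel) q∈
    in unique-∷ (λ y∈q → UP.Unique[x∷xs]⇒x∉xs uyr (to (q≐r y) y∈q)) uq , ≐-trans (≐-cons q≐r) yr≐D

  arrangements-complete : ∀ n {D p} → Unique D → length D ≡ n → Arrangement D p → p ∈ arrangements n D
  arrangements-complete zero {[]} {[]} _ _ _ = here refl
  arrangements-complete zero {[]} {y ∷ _} _ _ (_ , same) with to (same y) (here refl)
  ... | ()
  arrangements-complete (suc n) {x ∷ _} {[]} _ _ (_ , same) with from (same x) (here refl)
  ... | ()
  arrangements-complete (suc n) {D} {y ∷ q} u len (uyq , same) with select-complete (to (same y) (here refl))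
  ... | r , sel with select-sound u sel
  ... | uyr , yr≐D = ∈-concat⁺′ (∈-map⁺ (y ∷_) q∈) (∈-map⁺ (headedBy n) sel)
    where
    q∈ : q ∈ arrangements n r
    q∈ = arrangements-complete n (AP.tail uyr) (select-rest-length len sel)
           (AP.tail uyq , ≐-tail uyq uyr (≐-trans same (≐-sym yr≐D)))

  headedBy-disjoint : ∀ {n s t} → proj₁ s ≢ proj₁ t → Disjoint (headedBy n s) (headedBy n t)
  headedBy-disjoint {n} {s = y , r} {y′ , r′} ne (m , m′) with ∈-headedBy n y r m | ∈-headedBy n y′ r′ m′
  ... | _ , _ , refl | _ , _ , e = ne (∷-injectiveˡ e)

  arrangements-unique : ∀ n {D} → Unique D → Unique (arrangements n D)
  arrangements-unique zero u = [] ∷ []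
  arrangements-unique (suc n) {D} u =
    UP.concat⁺ (AllP.map⁺ (All.tabulate block-unique))
               (APP.map⁺ (AP.map (headedBy-disjoint {n}) heads-distinct))
    where
    block-unique : ∀ {s} → s ∈ select D → Unique (headedBy n s)
    block-unique sel = UP.map⁺ ∷-injectiveʳ (arrangements-unique n (AP.tail (proj₁ (select-sound u sel))))
    heads-distinct : AllPairs (_≢_ on proj₁) (select D)
    heads-distinct = APP.map⁻ (subst Unique (sym (select-heads D)) u)

  arrangements-count : ∀ n {D} → Unique D → length D ≡ n → length (arrangements n D) ≡ n !
  arrangements-count zero u len = refl
  arrangements-count (suc n) {D} u len =
    trans (length-concat-const (map (headedBy n) (select D)) (AllP.map⁺ (All.tabulate block-length)))
          (cong (_* n !) (trans (length-map (headedBy n) (select D)) select-count))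
    where
    block-length : ∀ {s} → s ∈ select D → length (headedBy n s) ≡ n !
    block-length {y , r} sel =
      trans (length-map (y ∷_) (arrangements n r))
            (arrangements-count n (AP.tail (proj₁ (select-sound u sel))) (select-rest-length len sel))
    select-count : length (select D) ≡ suc n
    select-count = trans (sym (length-map proj₁ (select D))) (trans (cong length (select-heads D)) len)

module PathsAndCycles {A : Set} (_≟_ : DecidableEquality A) where

  path : List A → PMap A
  path = pathMap _≟_

  cycle : List A → PMap A
  cycle = cycleMap _≟_

  path-skip : ∀ {y w} rest → w ≢ y → path (y ∷ rest) w ≡ path rest w
  path-skip [] _ = refl
  path-skip {y} {w} (_ ∷ _) w≢y rewrite dec-false (w ≟ y) w≢y = refl

  path-head : ∀ y z zs → path (y ∷ z ∷ zs) y ≡ just z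
  path-head y z zs rewrite dec-true (y ≟ y) refl = refl

  path-image : ∀ y rest {x z} → path (y ∷ rest) x ≡ just z → z ∈ rest
  path-image y [] ()
  path-image y (z′ ∷ zs) {x} eq with x ≟ y
  ... | yes _ = here (sym (just-injective eq))
  ... | no _ = there (path-image z′ zs eq)

  path-digits : ∀ xs {x z} → path xs x ≡ just z → z ∈ xs
  path-digits (y ∷ rest) eq = there (path-image y rest eq)

  path-closed : ∀ xs → Closed xs (path xs)
  path-closed xs _ = path-digits xs

  path-preimage : ∀ {y rest z} → Unique (y ∷ rest) → z ∈ rest →
    ∃ λ x → x ∈ y ∷ rest × path (y ∷ rest) x ≡ just z
  path-preimage {y} {z′ ∷ zs} u (here refl) = y , here refl , path-head y z′ zs
  path-preimage {y} {z′ ∷ zs} u (there m) with path-preimage (AP.tail u) m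
  ... | x , x∈ , eq = x , there x∈ , trans (path-skip (z′ ∷ zs) (≢-head u x∈)) eq

  -- Two paths through the same digits that agree as maps start at the same
  -- digit: the first digit is the only one without a preimage.
  path-head-determined : ∀ {y rest y′ rest′} → Unique (y ∷ rest) → Unique (y′ ∷ rest′) →
    y ∷ rest ≐ y′ ∷ rest′ → (∀ x → x ∈ y ∷ rest → path (y ∷ rest) x ≡ path (y′ ∷ rest′) x) →
    y ≡ y′
  path-head-determined {y} {rest} u u′ same agree with to (same y) (here refl)
  ... | here y≡y′ = y≡y′
  ... | there y∈rest′ with path-preimage u′ y∈rest′
  ... | x , x∈ , eq =
    ⊥-elim (UP.Unique[x∷xs]⇒x∉xs u (path-image y rest (trans (agree x (from (same x) x∈)) eq)))

  path-injective : ∀ xs ys → Unique xs → Unique ys → xs ≐ ys →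
    (∀ x → x ∈ xs → path xs x ≡ path ys x) → xs ≡ ys
  path-injective [] [] _ _ _ _ = refl
  path-injective [] (y ∷ _) _ _ same _ with from (same y) (here refl)
  ... | ()
  path-injective (x ∷ _) [] _ _ same _ with to (same x) (here refl)
  ... | ()
  path-injective (y ∷ rest) (y′ ∷ rest′) u u′ same agree
    with path-head-determined u u′ same agree
  ... | refl = cong (y ∷_) (path-injective rest rest′ (AP.tail u) (AP.tail u′) (≐-tail u u′ same) agree-tail)
    where
    open ≡-Reasoning
    agree-tail : ∀ x → x ∈ rest → path rest x ≡ path rest′ x
    agree-tail x m = begin
      path rest x            ≡⟨ sym (path-skip rest (≢-head u m)) ⟩
      path (y ∷ rest) x      ≡⟨ agree x (there m) ⟩
      path (y ∷ rest′) x     ≡⟨ path-skip rest′ (≢-head u m) ⟩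
      path rest′ x           ∎

  path-pow-tail : ∀ {y rest} → Unique (y ∷ rest) → ∀ k x → x ∈ rest →
    (path (y ∷ rest) ^ₚ k) x ≡ (path rest ^ₚ k) x
  path-pow-tail {rest = rest} u =
    ^ₚ-agree (λ x m → path-skip rest (≢-head u m)) (path-closed rest)

  path-pow-head : ∀ {y z zs} → Unique (y ∷ z ∷ zs) → ∀ k →
    (path (y ∷ z ∷ zs) ^ₚ suc k) y ≡ (path (z ∷ zs) ^ₚ k) z
  path-pow-head {y} {z} {zs} u k = begin
    (path (y ∷ z ∷ zs) ^ₚ suc k) y                    ≡⟨ ^ₚ-suc (path (y ∷ z ∷ zs)) k y ⟩
    (path (y ∷ z ∷ zs) y >>= (path (y ∷ z ∷ zs) ^ₚ k)) ≡⟨ cong (_>>= (path (y ∷ z ∷ zs) ^ₚ k)) (path-head y z zs) ⟩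
    (path (y ∷ z ∷ zs) ^ₚ k) z                        ≡⟨ path-pow-tail u k z (here refl) ⟩
    (path (z ∷ zs) ^ₚ k) z                            ∎
    where open ≡-Reasoning

  path-nilpotent : ∀ xs → Unique xs → ∀ k → length xs ≤ k → ∀ x → x ∈ xs → (path xs ^ₚ k) x ≡ nothing
  path-nilpotent (y ∷ []) u (suc k) _ x (here refl) = ^ₚ-suc (path (y ∷ [])) k y
  path-nilpotent (y ∷ z ∷ zs) u (suc k) (s≤s ℓ≤k) x (here refl) =
    trans (path-pow-head u k) (path-nilpotent (z ∷ zs) (AP.tail u) k ℓ≤k z (here refl))
  path-nilpotent (y ∷ rest) u (suc k) (s≤s ℓ≤k) x (there m) =
    trans (path-pow-tail u (suc k) x m)
          (cong (_>>= path rest) (path-nilpotent rest (AP.tail u) k ℓ≤k x m))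

  path-pow-defined : ∀ y rest → Unique (y ∷ rest) → ∀ k → k < length (y ∷ rest) →
    (path (y ∷ rest) ^ₚ k) y ≢ nothing
  path-pow-defined y rest u zero _ ()
  path-pow-defined y [] u (suc k) (s≤s ())
  path-pow-defined y (z ∷ zs) u (suc k) (s≤s k<ℓ) eq =
    path-pow-defined z zs (AP.tail u) k k<ℓ (trans (sym (path-pow-head u k)) eq)

  path-defined-before-last : ∀ l y {x} → x ∈ l → path (l ∷ʳ y) x ≢ nothing
  path-defined-before-last (u ∷ []) y (here refl) rewrite path-head u y [] = λ ()
  path-defined-before-last (u ∷ v ∷ l) y (here refl) rewrite path-head u v (l ∷ʳ y) = λ ()
  path-defined-before-last (u ∷ v ∷ l) y {x} (there m) with x ≟ u
  ... | yes _ = λ ()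
  ... | no _ = path-defined-before-last (v ∷ l) y m

  cycle-closed : ∀ xs → Closed xs (cycle xs)
  cycle-closed (y ∷ ys) _ eq with ∈-++⁻ (y ∷ ys) (path-digits ((y ∷ ys) ∷ʳ y) eq)
  ... | inj₁ m = m
  ... | inj₂ (here z≡y) = here z≡y

  cycle-pow-defined : ∀ xs k x → x ∈ xs → (cycle xs ^ₚ k) x ≢ nothing
  cycle-pow-defined xs = ^ₚ-total (cycle-total xs) (cycle-closed xs)
    where
    cycle-total : ∀ xs x → x ∈ xs → cycle xs x ≢ nothing
    cycle-total (y ∷ ys) x m = path-defined-before-last (y ∷ ys) y m

module VanishingProduct {A : Set} (_≟_ : DecidableEquality A) (k n : ℕ) (0<n : 0 < n)
  (ts : List (PathOrCycle _≟_))
  (unique-D : Unique (digitsOf _≟_ ts)) (length-D : length (digitsOf _≟_ ts) ≡ n)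
  (vanish : ∀ x → x ∈ digitsOf _≟_ ts → prodMap _≟_ ts x ≡ nothing) where

  open Arrangements
  open PathsAndCycles _≟_

  D : List A
  D = digitsOf _≟_ ts

  pow-vanishes : ∀ {β} → EqOn _≟_ D (β ^ₚ k) (prodMap _≟_ ts) → ∀ h xs → xs ≐ D →
    EqOn _≟_ D β h → Closed xs h → ∀ x → x ∈ xs → (h ^ₚ k) x ≡ nothing
  pow-vanishes {β} β^k≡τ h xs same β≡h cl x m = begin
    (h ^ₚ k) x      ≡⟨ sym (^ₚ-agree (λ y m′ → β≡h y (to (same y) m′)) cl k x m) ⟩
    (β ^ₚ k) x      ≡⟨ β^k≡τ x (to (same x) m) ⟩
    prodMap _≟_ ts x ≡⟨ vanish x (to (same x) m) ⟩
    nothing         ∎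
    where open ≡-Reasoning

  -- An interlacing is not a cycle, hence the path through an arrangement of D.
  interlacing-is-path : ∀ {β} → Interlacing _≟_ k ts β →
    ∃ λ xs → xs ∈ arrangements n D × EqOn _≟_ D β (path xs)
  interlacing-is-path ((xs , u , _ , same , inj₁ β≡path) , _) =
    xs , arrangements-complete n unique-D length-D (u , same) , β≡path
  interlacing-is-path ((y ∷ ys , _ , _ , same , inj₂ β≡cycle) , β^k≡τ) =
    ⊥-elim (cycle-pow-defined (y ∷ ys) k y (here refl)
             (pow-vanishes β^k≡τ (cycle (y ∷ ys)) (y ∷ ys) same β≡cycle (cycle-closed (y ∷ ys)) y (here refl)))
  interlacing-is-path (([] , _ , []≢[] , _ , inj₂ _) , _) = ⊥-elim ([]≢[] refl)

  arrangement-nonempty : ∀ {p} → p ∈ arrangements n D → p ≢ []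
  arrangement-nonempty m refl with () ← subst (0 <_) (sym (arrangements-length n D m)) 0<n

  arrangement-interlacing : ∀ {p} → p ∈ arrangements n D → n ≤ k → Interlacing _≟_ k ts (path p)
  arrangement-interlacing {p} m n≤k with arrangements-sound n unique-D length-D m
  ... | u , same = (p , u , arrangement-nonempty m , same , inj₁ (λ _ _ → refl)) , nilpotent
    where
    ℓ≤k : length p ≤ k
    ℓ≤k = subst (_≤ k) (sym (arrangements-length n D m)) n≤k
    nilpotent : EqOn _≟_ D (path p ^ₚ k) (prodMap _≟_ ts)
    nilpotent x x∈D = trans (path-nilpotent p u k ℓ≤k x (from (same x) x∈D)) (sym (vanish x x∈D))

  -- An interlacing forces n ≤ k: for k < n the k-th power of the path is
  -- still defined at its first digit.
  interlacing-bound : Σ (PMap A) (Interlacing _≟_ k ts) → n ≤ k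
  interlacing-bound (β , it@(_ , β^k≡τ)) = ≮⇒≥ k≮n
    where
    first-digit-survives : ∀ xs → xs ∈ arrangements n D → EqOn _≟_ D β (path xs) → ¬ k < n
    first-digit-survives [] m _ _ = arrangement-nonempty m refl
    first-digit-survives (y ∷ rest) m β≡path k<n with arrangements-sound n unique-D length-D m
    ... | u , same =
      path-pow-defined y rest u k (subst (k <_) (sym (arrangements-length n D m)) k<n)
        (pow-vanishes β^k≡τ (path (y ∷ rest)) (y ∷ rest) same β≡path (path-closed (y ∷ rest)) y (here refl))
    k≮n : ¬ k < n
    k≮n with interlacing-is-path it
    ... | xs , m , β≡path = first-digit-survives xs m β≡path

  interlacings-distinct : ∀ {p q} → p ∈ arrangements n D → q ∈ arrangements n D → p ≢ q →
    ¬ EqOn _≟_ D (path p) (path q)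
  interlacings-distinct {p} {q} mp mq p≢q agree
    with arrangements-sound n unique-D length-D mp | arrangements-sound n unique-D length-D mq
  ... | up , p≐D | uq , q≐D =
    p≢q (path-injective p q up uq (≐-trans p≐D (≐-sym q≐D)) (λ x m → agree x (to (p≐D x) m)))

  interlacing-count : n ≤ k → PhiEq _≟_ k ts (n !)
  interlacing-count n≤k =
    map path (arrangements n D) ,
    trans (length-map path (arrangements n D)) (arrangements-count n unique-D length-D) ,
    AllP.map⁺ (All.tabulate (λ m → arrangement-interlacing m n≤k)) ,
    APP.map⁺ (AllPairs-from-members interlacings-distinct (arrangements-unique n unique-D)) ,
    every-interlacing-listed
    where
    every-interlacing-listed : ∀ β → Interlacing _≟_ k ts β → Any (EqOn _≟_ D β) (map path (arrangements n D))
    every-interlacing-listed β it with interlacing-is-path it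
    ... | xs , m , β≡path = AnyP.map⁺ (lose m β≡path)

  theorem : (Σ (PMap A) (Interlacing _≟_ k ts) ⇔ n ≤ k) × (n ≤ k → PhiEq _≟_ k ts (n !))
  theorem = mk⇔ interlacing-bound (λ n≤k → path D , arrangement-interlacing D∈ n≤k) , interlacing-count
    where
    D∈ : D ∈ arrangements n D
    D∈ = arrangements-complete n unique-D length-D (unique-D , λ _ → ⇔.refl)

module _ {A : Set} (_≟_ : DecidableEquality A) {I : Set} (a : I → A) where

  lengthOnePaths : List I → List (PathOrCycle _≟_)
  lengthOnePaths = map (λ i → (a i ∷ []) , false)

  lengthOnePaths-digits : ∀ is → digitsOf _≟_ (lengthOnePaths is) ≡ map a is
  lengthOnePaths-digits [] = refl
  lengthOnePaths-digits (i ∷ is) = cong (a i ∷_) (lengthOnePaths-digits is)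

  lengthOnePaths-vanish : ∀ is x → prodMap _≟_ (lengthOnePaths is) x ≡ nothing
  lengthOnePaths-vanish [] x = refl
  lengthOnePaths-vanish (i ∷ is) x = either-branch-nothing _ (lengthOnePaths-vanish is x)
    where
    either-branch-nothing : ∀ b {m : Maybe A} → m ≡ nothing → (if b then nothing else m) ≡ nothing
    either-branch-nothing true _ = refl
    either-branch-nothing false m≡nothing = m≡nothing

lemma5 : {A : Set} (_≟_ : DecidableEquality A) (k n : ℕ) → 0 < k → 0 < n →
    (a : Fin n → A) → Injective _≡_ _≡_ a →
    ((Σ (PMap A) (Interlacing _≟_ k (map (λ i → (a i ∷ []) , false) (allFin n)))) ⇔ (n ≤ k))
    × (n ≤ k → PhiEq _≟_ k (map (λ i → (a i ∷ []) , false) (allFin n)) (n !))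
lemma5 _≟_ k n _ 0<n a a-injective =
  VanishingProduct.theorem _≟_ k n 0<n (lengthOnePaths _≟_ a (allFin n))
    unique-digits length-digits (λ x _ → lengthOnePaths-vanish _≟_ a (allFin n) x)
  where
  digits≡ : digitsOf _≟_ (lengthOnePaths _≟_ a (allFin n)) ≡ map a (allFin n)
  digits≡ = lengthOnePaths-digits _≟_ a (allFin n)
  unique-digits : Unique (digitsOf _≟_ (lengthOnePaths _≟_ a (allFin n)))
  unique-digits = subst Unique (sym digits≡) (UP.map⁺ a-injective (UP.allFin⁺ n))
  length-digits : length (digitsOf _≟_ (lengthOnePaths _≟_ a (allFin n))) ≡ n
  length-digits = trans (cong length digits≡) (trans (length-map a (allFin n)) (length-tabulate (λ i → i)))
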